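{- $\mu(n)\in O(\log n/\log\log n)$ as $n\to\infty$.
   Context: A matroid on a finite set $S$ is a family $\mathcal{M}$ of subsets of $S$ with $\emptyset\in\mathcal{M}$, closed under subsets, such that for every $A\subseteq S$ all maximal members of $\mathcal{M}$ contained in $A$ have the same cardinality. For a finite simple graph $G=(V,E)$, $M(G)$ is the family of all matchings (sets of pairwise disjoint edges) of $G$, and $\mu(G)$ is the minimum $m\in\mathbb{N}$ such that $M(G)$ is the intersection $\mathcal{M}_1\cap\dots\cap\mathcal{M}_m$ of $m$ matroids on $E$. For $n\in\mathbb{N}$, $\mu(n)=\max\{\mu(G): G \text{ a finite simple graph with } |V|\le n\}$. -}

module Defs where

open import Data.Nat using (ℕ)
open import Data.Fin using (Fin)
open import Data.Fin.Subset using (Subset; _∈_; _⊆_; ⊥; ∣_∣)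
open import Data.Product using (_×_)
open import Data.Sum using (_⊎_)
open import Relation.Nullary using (¬_)
open import Relation.Binary.PropositionalEquality using (_≡_; _≢_)
open import Function.Bundles using (_⇔_)

record SimpleGraph : Set where
  field
    vertices : ℕ
    edges    : ℕ
    end₁     : Fin edges → Fin vertices
    end₂     : Fin edges → Fin vertices
    loopless : ∀ e → end₁ e ≢ end₂ e
    simple   : ∀ e f → e ≢ f →
               ¬ ((end₁ e ≡ end₁ f × end₂ e ≡ end₂ f) ⊎
                  (end₁ e ≡ end₂ f × end₂ e ≡ end₁ f))
open SimpleGraph public

Disjoint : (G : SimpleGraph) → Fin (edges G) → Fin (edges G) → Set
Disjoint G e f =
  end₁ G e ≢ end₁ G f × end₁ G e ≢ end₂ G f ×
  end₂ G e ≢ end₁ G f × end₂ G e ≢ end₂ G f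

IsMatching : (G : SimpleGraph) → Subset (edges G) → Set
IsMatching G X = ∀ e f → e ∈ X → f ∈ X → e ≢ f → Disjoint G e f

Family : ℕ → Set₁
Family k = Subset k → Set

MaximalIn : ∀ {k} → Family k → Subset k → Subset k → Set
MaximalIn ℳ A X = X ⊆ A × ℳ X × (∀ Z → X ⊆ Z → Z ⊆ A → ℳ Z → Z ≡ X)

record IsMatroid {k : ℕ} (ℳ : Family k) : Set where
  field
    has-∅      : ℳ ⊥
    down-closed : ∀ X Y → X ⊆ Y → ℳ Y → ℳ X
    equicard   : ∀ A X Y → MaximalIn ℳ A X → MaximalIn ℳ A Y → ∣ X ∣ ≡ ∣ Y ∣

IsMatroidIntersection : (G : SimpleGraph) (m : ℕ) → (Fin m → Family (edges G)) → Set
IsMatroidIntersection G m ℳ =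
  (∀ i → IsMatroid (ℳ i)) × (∀ X → IsMatching G X ⇔ (∀ i → ℳ i X))

-- Suppose m orientations of partial tournaments on V(G) are given such that
-- every cherry v – u – w (u ≠ v, u ≠ w) is directed out of u in one of them. In
-- orientation i let each edge be owned by its tail, or by itself if it is not
-- oriented; the edge sets with pairwise distinct owners form a partition
-- matroid. A matching has distinct owners in every orientation, whereas two
-- edges uv, uw at a common vertex u are both owned by u in the orientation
-- covering the cherry v – u – w. Lexicographic squaring turns such a family on
-- N vertices into one of size m + 4 on N² vertices, so 2^2^k vertices need only
-- 4k + 2 orientations, and k = 1 + ⌊log₂ ⌊log₂ n⌋⌋ suffices for n vertices.

module Submission where

open import Defs
open import Data.Nat using (ℕ; _≤_; _*_)
open import Data.Nat.Logarithm using (⌊log₂_⌋)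
open import Data.Fin using (Fin)
open import Data.Product using (Σ; _×_; ∃-syntax)

open import Data.Bool using (Bool; true; false; if_then_else_)
open import Data.Bool.Properties using (T-≡)
open import Data.Empty using (⊥; ⊥-elim)
open import Data.Fin using (zero; suc; toℕ; _↑ʳ_)
open import Data.Fin.Properties
  using (suc-injective; injective⇒≤; any?; _<?_; <-asym; <-cmp; *↔×; inject≤-injective)
  renaming (_≟_ to _≟ᶠ_)
open import Data.Fin.Subset using (Subset; _∈_; _⊆_; ∣_∣; inside; outside; _∪_; ⁅_⁆)
open import Data.Fin.Subset.Properties
  using (_∈?_; ∉⊥; x∈⁅x⁆; x∈⁅y⁆⇒x≡y; p⊆p∪q; x∈p∪q⁻; x∈p∪q⁺)
open import Data.Nat using (zero; suc; _<_; _+_; _^_; z≤n; s≤s; ⌊_/2⌋; ⌈_/2⌉; NonZero)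
open import Data.Nat.Induction using (<-wellFounded)
open import Data.Nat.Logarithm using (⌊log₂⌋-mono-≤; ⌊log₂⌊n/2⌋⌋≡⌊log₂n⌋∸1; ⌊log₂[2^n]⌋≡n)
open import Data.Nat.Properties
  using ( ≤-antisym; ≤-refl; ≤-reflexive; ≤-trans; <⇒≤; ≤-<-trans; ≮⇒≥; 1+n≰n; n≤1+n
        ; m≤m+n; <ᵇ⇒<; +-identityʳ; +-mono-≤; +-monoʳ-≤; *-suc; *-monoʳ-≤
        ; m^n>0; ^-monoʳ-≤; ^-distribˡ-+-*; ⌊n/2⌋≤⌈n/2⌉; ⌊n/2⌋+⌈n/2⌉≡n; ⌊n/2⌋<n
        ; module ≤-Reasoning )
  renaming (_<?_ to _<?ⁿ_)
open import Data.Nat.Tactic.RingSolver using (solve-∀)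
open import Data.Product using (_,_; proj₁; proj₂)
open import Data.Sum using (_⊎_; inj₁; inj₂)
open import Data.Sum.Properties using (inj₁-injective; inj₂-injective) renaming (≡-dec to ⊎-≡-dec)
open import Data.Vec.Base using (_∷_; here; there)
open import Function using (flip; _∘_)
open import Function.Bundles using (_↣_; mk↣; mk⇔; Injection; Equivalence)
open import Function.Properties.Inverse using (↔⇒↣)
open import Induction.WellFounded using (Acc; acc)
open import Relation.Binary.Definitions using (DecidableEquality; tri<; tri≈; tri>)
open import Relation.Binary.PropositionalEquality
  using (_≡_; _≢_; refl; sym; trans; cong; cong₂; subst)
open import Relation.Nullary using (yes; no; does; contradiction)
open import Relation.Nullary.Decidable using (_×-dec_; dec-true; dec-false)

index : ∀ {n} (p : Subset n) {x : Fin n} → x ∈ p → Fin ∣ p ∣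
index (inside ∷ p) here = zero
index (inside ∷ p) (there x∈p) = suc (index p x∈p)
index (outside ∷ p) (there x∈p) = index p x∈p

index-injective : ∀ {n} (p : Subset n) {x y : Fin n} (x∈p : x ∈ p) (y∈p : y ∈ p) →
                  index p x∈p ≡ index p y∈p → x ≡ y
index-injective (inside ∷ p) here here _ = refl
index-injective (inside ∷ p) (there x∈p) (there y∈p) eq =
  cong suc (index-injective p x∈p y∈p (suc-injective eq))
index-injective (outside ∷ p) (there x∈p) (there y∈p) eq =
  cong suc (index-injective p x∈p y∈p eq)

member : ∀ {n} (p : Subset n) → Fin ∣ p ∣ → Fin n
member (inside ∷ p) zero = zero
member (inside ∷ p) (suc i) = suc (member p i)
member (outside ∷ p) i = suc (member p i)

member-∈ : ∀ {n} (p : Subset n) (i : Fin ∣ p ∣) → member p i ∈ p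
member-∈ (inside ∷ p) zero = here
member-∈ (inside ∷ p) (suc i) = there (member-∈ p i)
member-∈ (outside ∷ p) i = there (member-∈ p i)

member-injective : ∀ {n} (p : Subset n) {i j : Fin ∣ p ∣} → member p i ≡ member p j → i ≡ j
member-injective (inside ∷ p) {zero} {zero} _ = refl
member-injective (inside ∷ p) {suc i} {suc j} eq = cong suc (member-injective p (suc-injective eq))
member-injective (outside ∷ p) eq = member-injective p (suc-injective eq)

∣p∣≤∣q∣-by-injection : ∀ {n} (p q : Subset n) (h : ∀ {x} → x ∈ p → Fin n) →
                       (∀ {x} (x∈p : x ∈ p) → h x∈p ∈ q) →
                       (∀ {x y} (x∈p : x ∈ p) (y∈p : y ∈ p) → h x∈p ≡ h y∈p → x ≡ y) →
                       ∣ p ∣ ≤ ∣ q ∣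
∣p∣≤∣q∣-by-injection p q h h∈q h-injective =
  injective⇒≤ {f = λ i → index q (h∈q (member-∈ p i))}
    (λ eq → member-injective p (h-injective _ _ (index-injective q _ _ eq)))

InjectiveOn : ∀ {k} {C : Set} → (Fin k → C) → Family k
InjectiveOn c X = ∀ {a b} → a ∈ X → b ∈ X → c a ≡ c b → a ≡ b

module _ {k : ℕ} {C : Set} (_≟_ : DecidableEquality C) (c : Fin k → C) where

  injectiveOn-∪⁅⁆ : ∀ {Y e} → InjectiveOn c Y → (∀ {y} → y ∈ Y → c y ≢ c e) →
                    InjectiveOn c (Y ∪ ⁅ e ⁆)
  injectiveOn-∪⁅⁆ {Y} {e} injY fresh a∈ b∈ eq with x∈p∪q⁻ Y ⁅ e ⁆ a∈ | x∈p∪q⁻ Y ⁅ e ⁆ b∈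
  ... | inj₁ a∈Y | inj₁ b∈Y = injY a∈Y b∈Y eq
  ... | inj₁ a∈Y | inj₂ b∈e with refl ← x∈⁅y⁆⇒x≡y e b∈e = ⊥-elim (fresh a∈Y eq)
  ... | inj₂ a∈e | inj₁ b∈Y with refl ← x∈⁅y⁆⇒x≡y e a∈e = ⊥-elim (fresh b∈Y (sym eq))
  ... | inj₂ a∈e | inj₂ b∈e = trans (x∈⁅y⁆⇒x≡y e a∈e) (sym (x∈⁅y⁆⇒x≡y e b∈e))

  maximal-meets-every-colour : ∀ {A Y e} → MaximalIn (InjectiveOn c) A Y → e ∈ A →
                               ∃[ y ] (y ∈ Y × c y ≡ c e)
  maximal-meets-every-colour {A} {Y} {e} (Y⊆A , injY , maximal) e∈A
    with any? (λ y → (y ∈? Y) ×-dec (c y ≟ c e))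
  ... | yes found = found
  ... | no none = ⊥-elim (none (e , subst (e ∈_) Y∪e≡Y (x∈p∪q⁺ (inj₂ (x∈⁅x⁆ e))) , refl))
    where
    Y∪e⊆A : Y ∪ ⁅ e ⁆ ⊆ A
    Y∪e⊆A x∈ with x∈p∪q⁻ Y ⁅ e ⁆ x∈
    ... | inj₁ x∈Y = Y⊆A x∈Y
    ... | inj₂ x∈e with refl ← x∈⁅y⁆⇒x≡y e x∈e = e∈A

    Y∪e≡Y : Y ∪ ⁅ e ⁆ ≡ Y
    Y∪e≡Y = maximal (Y ∪ ⁅ e ⁆) (p⊆p∪q ⁅ e ⁆) Y∪e⊆A
              (injectiveOn-∪⁅⁆ injY (λ y∈Y eq → none (_ , y∈Y , eq)))

  maximal-∣∣-≤ : ∀ {A X Y} → MaximalIn (InjectiveOn c) A X → MaximalIn (InjectiveOn c) A Y →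
                 ∣ X ∣ ≤ ∣ Y ∣
  maximal-∣∣-≤ {X = X} {Y} (X⊆A , injX , _) maxY =
    ∣p∣≤∣q∣-by-injection X Y (proj₁ ∘ colourIn) (proj₁ ∘ proj₂ ∘ colourIn)
      (λ x∈X x'∈X eq → injX x∈X x'∈X
        (trans (sym (proj₂ (proj₂ (colourIn x∈X))))
          (trans (cong c eq) (proj₂ (proj₂ (colourIn x'∈X))))))
    where
    colourIn : ∀ {x} → x ∈ X → ∃[ y ] (y ∈ Y × c y ≡ c x)
    colourIn x∈X = maximal-meets-every-colour maxY (X⊆A x∈X)

  injectiveOn-isMatroid : IsMatroid (InjectiveOn c)
  injectiveOn-isMatroid = record
    { has-∅       = λ a∈∅ → ⊥-elim (∉⊥ a∈∅)
    ; down-closed = λ X Y X⊆Y injY a∈X b∈X → injY (X⊆Y a∈X) (X⊆Y b∈X)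
    ; equicard    = λ A X Y maxX maxY → ≤-antisym (maximal-∣∣-≤ maxX maxY) (maximal-∣∣-≤ maxY maxX)
    }

Asymᵇ : {A : Set} → (A → A → Bool) → Set
Asymᵇ R = ∀ x y → R x y ≡ true → R y x ≡ false

record CherryCover (A : Set) (m : ℕ) : Set where
  field
    arc      : Fin m → A → A → Bool
    arc-asym : ∀ i → Asymᵇ (arc i)
    cherry   : ∀ u v w → u ≢ v → u ≢ w → ∃[ i ] (arc i u v ≡ true × arc i u w ≡ true)

cherryCover-↣ : ∀ {A B m} → B ↣ A → CherryCover A m → CherryCover B m
cherryCover-↣ f K = record
  { arc      = λ i x y → arc i (to x) (to y)
  ; arc-asym = λ i x y → arc-asym i (to x) (to y)
  ; cherry   = λ u v w u≢v u≢w → cherry (to u) (to v) (to w) (u≢v ∘ injective) (u≢w ∘ injective)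
  }
  where
  open Injection f
  open CherryCover K

record Tournament (A : Set) : Set where
  field
    beats       : A → A → Bool
    beats-asym  : Asymᵇ beats
    beats-total : ∀ {x y} → x ≢ y → beats x y ≡ true ⊎ beats y x ≡ true

  orient : Bool → A → A → Bool
  orient true  = beats
  orient false = flip beats

  orient-asym : ∀ s → Asymᵇ (orient s)
  orient-asym true  x y = beats-asym x y
  orient-asym false x y = beats-asym y x

  orient-total : ∀ {x y} → x ≢ y → ∃[ s ] orient s x y ≡ true
  orient-total x≢y with beats-total x≢y
  ... | inj₁ x→y = true , x→y
  ... | inj₂ y→x = false , y→x

<-tournament : ∀ {N} → Tournament (Fin N)
<-tournament = record
  { beats = λ x y → does (x <? y) ; beats-asym = beats-asym ; beats-total = beats-total }
  where
  beats-asym : ∀ {N} (x y : Fin N) → does (x <? y) ≡ true → does (y <? x) ≡ false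
  beats-asym x y x→y =
    dec-false (y <? x) (<-asym (<ᵇ⇒< (toℕ x) (toℕ y) (Equivalence.from T-≡ x→y)))

  beats-total : ∀ {N} {x y : Fin N} → x ≢ y → does (x <? y) ≡ true ⊎ does (y <? x) ≡ true
  beats-total {x = x} {y} x≢y with <-cmp x y
  ... | tri< x<y _ _ = inj₁ (dec-true (x <? y) x<y)
  ... | tri≈ _ x≡y _ = ⊥-elim (x≢y x≡y)
  ... | tri> _ _ y<x = inj₂ (dec-true (y <? x) y<x)

module _ {A : Set} (_≟_ : DecidableEquality A) where

  lex : (A → A → Bool) → (A → A → Bool) → A × A → A × A → Bool
  lex R S (a , b) (a' , b') = if does (a ≟ a') then S b b' else R a a'

  lex-≡ : ∀ R S {a a' b b'} → a ≡ a' → lex R S (a , b) (a' , b') ≡ S b b'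
  lex-≡ R S {a} refl rewrite dec-true (a ≟ a) refl = refl

  lex-≢ : ∀ R S {a a' b b'} → a ≢ a' → lex R S (a , b) (a' , b') ≡ R a a'
  lex-≢ R S {a} {a'} a≢a' rewrite dec-false (a ≟ a') a≢a' = refl

  lex-asym : ∀ {R S} → Asymᵇ R → Asymᵇ S → Asymᵇ (lex R S)
  lex-asym {R} {S} R-asym S-asym (a , b) (a' , b') p→q with a ≟ a'
  ... | yes a≡a' = trans (lex-≡ R S (sym a≡a')) (S-asym b b' p→q)
  ... | no a≢a'  = trans (lex-≢ R S (a≢a' ∘ sym)) (R-asym a a' p→q)

  -- A cherry (a' , b') – (a , b) – (a'' , b'') is covered by the lexicographic square of
  -- an old orientation if a ∉ {a' , a''} or a = a' = a''; the two mixed cases need the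
  -- four lexicographic products of the tournament and its reverse.
  lexSquare : ∀ {m} → Tournament A → CherryCover A m → CherryCover (A × A) (4 + m)
  lexSquare {m} T K = record { arc = arc ; arc-asym = arc-asym ; cherry = cherry² }
    where
    open Tournament T
    open CherryCover K renaming (arc to arc₁; arc-asym to arc₁-asym; cherry to cherry₁)

    arc : Fin (4 + m) → A × A → A × A → Bool
    arc zero                            = lex (orient true) (orient true)
    arc (suc zero)                      = lex (orient true) (orient false)
    arc (suc (suc zero))                = lex (orient false) (orient true)
    arc (suc (suc (suc zero)))          = lex (orient false) (orient false)
    arc (suc (suc (suc (suc i))))       = lex (arc₁ i) (arc₁ i)

    arc-asym : ∀ j → Asymᵇ (arc j)
    arc-asym zero                       = lex-asym (orient-asym true) (orient-asym true)
    arc-asym (suc zero)                 = lex-asym (orient-asym true) (orient-asym false)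
    arc-asym (suc (suc zero))           = lex-asym (orient-asym false) (orient-asym true)
    arc-asym (suc (suc (suc zero)))     = lex-asym (orient-asym false) (orient-asym false)
    arc-asym (suc (suc (suc (suc i))))  = lex-asym (arc₁-asym i) (arc₁-asym i)

    orientIndex : Bool → Bool → Fin (4 + m)
    orientIndex true  true  = zero
    orientIndex true  false = suc zero
    orientIndex false true  = suc (suc zero)
    orientIndex false false = suc (suc (suc zero))

    arc-orientIndex : ∀ s t p q → arc (orientIndex s t) p q ≡ lex (orient s) (orient t) p q
    arc-orientIndex true  true  p q = refl
    arc-orientIndex true  false p q = refl
    arc-orientIndex false true  p q = refl
    arc-orientIndex false false p q = refl

    cherry² : ∀ u v w → u ≢ v → u ≢ w → ∃[ j ] (arc j u v ≡ true × arc j u w ≡ true)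
    cherry² (a , b) (a' , b') (a'' , b'') u≢v u≢w with a ≟ a' | a ≟ a''
    ... | no a≢a' | no a≢a''
        with i , a→a' , a→a'' ← cherry₁ a a' a'' a≢a' a≢a''
        = 4 ↑ʳ i , trans (lex-≢ (arc₁ i) (arc₁ i) a≢a') a→a'
          , trans (lex-≢ (arc₁ i) (arc₁ i) a≢a'') a→a''
    ... | yes a≡a' | yes a≡a''
        with i , b→b' , b→b'' ← cherry₁ b b' b'' (u≢v ∘ cong₂ _,_ a≡a') (u≢w ∘ cong₂ _,_ a≡a'')
        = 4 ↑ʳ i , trans (lex-≡ (arc₁ i) (arc₁ i) a≡a') b→b'
          , trans (lex-≡ (arc₁ i) (arc₁ i) a≡a'') b→b''
    ... | yes a≡a' | no a≢a''
        with s , a→a'' ← orient-total a≢a''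
           | t , b→b' ← orient-total (u≢v ∘ cong₂ _,_ a≡a')
        = orientIndex s t
        , trans (arc-orientIndex s t _ _) (trans (lex-≡ (orient s) (orient t) a≡a') b→b')
        , trans (arc-orientIndex s t _ _) (trans (lex-≢ (orient s) (orient t) a≢a'') a→a'')
    ... | no a≢a' | yes a≡a''
        with s , a→a' ← orient-total a≢a'
           | t , b→b'' ← orient-total (u≢w ∘ cong₂ _,_ a≡a'')
        = orientIndex s t
        , trans (arc-orientIndex s t _ _) (trans (lex-≢ (orient s) (orient t) a≢a') a→a')
        , trans (arc-orientIndex s t _ _) (trans (lex-≡ (orient s) (orient t) a≡a'') b→b'')

cherryCover-≤ : ∀ {M N m} → M ≤ N → CherryCover (Fin N) m → CherryCover (Fin M) m
cherryCover-≤ M≤N = cherryCover-↣ (mk↣ (λ {i} {j} → inject≤-injective M≤N M≤N i j))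

cherryCover-* : ∀ {N m} → CherryCover (Fin N) m → CherryCover (Fin (N * N)) (4 + m)
cherryCover-* K = cherryCover-↣ (↔⇒↣ *↔×) (lexSquare _≟ᶠ_ <-tournament K)

cherryCover-2 : CherryCover (Fin 2) 2
cherryCover-2 = record
  { arc = orient ∘ isZero ; arc-asym = orient-asym ∘ isZero ; cherry = cherry }
  where
  open Tournament <-tournament

  isZero : Fin 2 → Bool
  isZero zero    = true
  isZero (suc _) = false

  cherry : ∀ u v w → u ≢ v → u ≢ w →
           ∃[ i ] (orient (isZero i) u v ≡ true × orient (isZero i) u w ≡ true)
  cherry zero       zero       _          u≢v _   = ⊥-elim (u≢v refl)
  cherry zero       (suc zero) zero       _   u≢w = ⊥-elim (u≢w refl)
  cherry zero       (suc zero) (suc zero) _   _   = zero , refl , refl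
  cherry (suc zero) (suc zero) _          u≢v _   = ⊥-elim (u≢v refl)
  cherry (suc zero) zero       (suc zero) _   u≢w = ⊥-elim (u≢w refl)
  cherry (suc zero) zero       zero       _   _   = suc zero , refl , refl

2^2^[1+k]≡2^2^k*2^2^k : ∀ k → 2 ^ 2 ^ suc k ≡ 2 ^ 2 ^ k * 2 ^ 2 ^ k
2^2^[1+k]≡2^2^k*2^2^k k = trans (^-distribˡ-+-* 2 (2 ^ k) (2 ^ k + 0))
                                (cong (λ e → 2 ^ 2 ^ k * 2 ^ e) (+-identityʳ (2 ^ k)))

cherryCover-2^2^ : ∀ k → CherryCover (Fin (2 ^ 2 ^ k)) (k * 4 + 2)
cherryCover-2^2^ zero    = cherryCover-2
cherryCover-2^2^ (suc k) =
  cherryCover-≤ (≤-reflexive (2^2^[1+k]≡2^2^k*2^2^k k)) (cherryCover-* (cherryCover-2^2^ k))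

module _ (G : SimpleGraph) {m : ℕ} (K : CherryCover (Fin (vertices G)) m) where
  open CherryCover K

  Endpoint : Fin (vertices G) → Fin (edges G) → Set
  Endpoint u e = u ≡ end₁ G e ⊎ u ≡ end₂ G e

  Joins : Fin (edges G) → Fin (vertices G) → Fin (vertices G) → Set
  Joins e u v = (end₁ G e ≡ u × end₂ G e ≡ v) ⊎ (end₁ G e ≡ v × end₂ G e ≡ u)

  owner : Fin m → Fin (edges G) → Fin (vertices G) ⊎ Fin (edges G)
  owner i e = if arc i (end₁ G e) (end₂ G e) then inj₁ (end₁ G e)
              else if arc i (end₂ G e) (end₁ G e) then inj₁ (end₂ G e)
              else inj₂ e

  owner-endpoint : ∀ {i e u} → owner i e ≡ inj₁ u → Endpoint u e
  owner-endpoint {i} {e} eq with arc i (end₁ G e) (end₂ G e) | arc i (end₂ G e) (end₁ G e)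
  ... | true  | _     = inj₁ (sym (inj₁-injective eq))
  ... | false | true  = inj₂ (sym (inj₁-injective eq))

  owner-self : ∀ {i e f} → owner i e ≡ inj₂ f → e ≡ f
  owner-self {i} {e} eq with arc i (end₁ G e) (end₂ G e) | arc i (end₂ G e) (end₁ G e)
  ... | false | false = inj₂-injective eq

  owner-tail : ∀ {i a u v} → Joins a u v → arc i u v ≡ true → owner i a ≡ inj₁ u
  owner-tail (inj₁ (refl , refl)) u→v rewrite u→v = refl
  owner-tail {i} (inj₂ (refl , refl)) u→v rewrite arc-asym i _ _ u→v | u→v = refl

  joins-loopless : ∀ {a u v} → Joins a u v → u ≢ v
  joins-loopless {a} (inj₁ (refl , refl)) = loopless G a
  joins-loopless {a} (inj₂ (refl , refl)) = loopless G a ∘ sym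

  joins-simple : ∀ {a b u v} → a ≢ b → Joins a u v → Joins b u v → ⊥
  joins-simple a≢b (inj₁ (refl , refl)) (inj₁ (b₁ , b₂)) = simple G _ _ a≢b (inj₁ (sym b₁ , sym b₂))
  joins-simple a≢b (inj₁ (refl , refl)) (inj₂ (b₁ , b₂)) = simple G _ _ a≢b (inj₂ (sym b₂ , sym b₁))
  joins-simple a≢b (inj₂ (refl , refl)) (inj₁ (b₁ , b₂)) = simple G _ _ a≢b (inj₂ (sym b₂ , sym b₁))
  joins-simple a≢b (inj₂ (refl , refl)) (inj₂ (b₁ , b₂)) = simple G _ _ a≢b (inj₁ (sym b₁ , sym b₂))

  disjoint⇒¬common-endpoint : ∀ {a b u} → Disjoint G a b → Endpoint u a → Endpoint u b → ⊥
  disjoint⇒¬common-endpoint (d₁₁ , _ , _ , _) (inj₁ p) (inj₁ q) = d₁₁ (trans (sym p) q)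
  disjoint⇒¬common-endpoint (_ , d₁₂ , _ , _) (inj₁ p) (inj₂ q) = d₁₂ (trans (sym p) q)
  disjoint⇒¬common-endpoint (_ , _ , d₂₁ , _) (inj₂ p) (inj₁ q) = d₂₁ (trans (sym p) q)
  disjoint⇒¬common-endpoint (_ , _ , _ , d₂₂) (inj₂ p) (inj₂ q) = d₂₂ (trans (sym p) q)

  disjoint⇒owner-≢ : ∀ {i a b} → a ≢ b → Disjoint G a b → owner i a ≢ owner i b
  disjoint⇒owner-≢ {i} {a} {b} a≢b disjoint eq = sameOwner (owner i a) refl (sym eq)
    where
    sameOwner : ∀ o → owner i a ≡ o → owner i b ≡ o → ⊥
    sameOwner (inj₁ u) a↦u b↦u =
      disjoint⇒¬common-endpoint disjoint (owner-endpoint a↦u) (owner-endpoint b↦u)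
    sameOwner (inj₂ f) a↦f b↦f = a≢b (trans (owner-self a↦f) (sym (owner-self b↦f)))

  matching⇒injectiveOn : ∀ {X} → IsMatching G X → ∀ i → InjectiveOn (owner i) X
  matching⇒injectiveOn matching i {a} {b} a∈X b∈X eq with a ≟ᶠ b
  ... | yes a≡b = a≡b
  ... | no a≢b  = ⊥-elim (disjoint⇒owner-≢ a≢b (matching a b a∈X b∈X a≢b) eq)

  shared-vertex⇒≡ : ∀ {X a b u v w} → (∀ i → InjectiveOn (owner i) X) → a ∈ X → b ∈ X →
                    Joins a u v → Joins b u w → a ≡ b
  shared-vertex⇒≡ {a = a} {b} {u} {v} {w} injective a∈X b∈X uv uw with v ≟ᶠ w | a ≟ᶠ b
  ... | _        | yes a≡b  = a≡b
  ... | yes refl | no a≢b   = ⊥-elim (joins-simple a≢b uv uw)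
  ... | no _     | no _
      with i , u→v , u→w ← cherry u v w (joins-loopless uv) (joins-loopless uw)
      = injective i a∈X b∈X (trans (owner-tail uv u→v) (sym (owner-tail uw u→w)))

  injectiveOn⇒matching : ∀ {X} → (∀ i → InjectiveOn (owner i) X) → IsMatching G X
  injectiveOn⇒matching injective a b a∈X b∈X a≢b =
      (λ e → a≢b (shared-vertex⇒≡ injective a∈X b∈X (inj₁ (refl , refl)) (inj₁ (sym e , refl))))
    , (λ e → a≢b (shared-vertex⇒≡ injective a∈X b∈X (inj₁ (refl , refl)) (inj₂ (refl , sym e))))
    , (λ e → a≢b (shared-vertex⇒≡ injective a∈X b∈X (inj₂ (refl , refl)) (inj₁ (sym e , refl))))
    , (λ e → a≢b (shared-vertex⇒≡ injective a∈X b∈X (inj₂ (refl , refl)) (inj₂ (refl , sym e))))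

  matchings-as-matroid-intersection : Σ (Fin m → Family (edges G)) (IsMatroidIntersection G m)
  matchings-as-matroid-intersection =
      (λ i → InjectiveOn (owner i))
    , (λ i → injectiveOn-isMatroid (⊎-≡-dec _≟ᶠ_ _≟ᶠ_) (owner i))
    , (λ X → mk⇔ matching⇒injectiveOn injectiveOn⇒matching)

n<2^[1+⌊log₂n⌋] : ∀ n → n < 2 ^ suc ⌊log₂ n ⌋
n<2^[1+⌊log₂n⌋] n with n <?ⁿ 2 ^ suc ⌊log₂ n ⌋
... | yes n< = n<
... | no n≮ = contradiction
  (subst (_≤ ⌊log₂ n ⌋) (⌊log₂[2^n]⌋≡n (suc ⌊log₂ n ⌋)) (⌊log₂⌋-mono-≤ (≮⇒≥ n≮))) 1+n≰n

2*⌊n/2⌋≤n : ∀ n → 2 * ⌊ n /2⌋ ≤ n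
2*⌊n/2⌋≤n n = begin
  2 * ⌊ n /2⌋          ≡⟨ cong (⌊ n /2⌋ +_) (+-identityʳ ⌊ n /2⌋) ⟩
  ⌊ n /2⌋ + ⌊ n /2⌋    ≤⟨ +-monoʳ-≤ ⌊ n /2⌋ (⌊n/2⌋≤⌈n/2⌉ n) ⟩
  ⌊ n /2⌋ + ⌈ n /2⌉    ≡⟨ ⌊n/2⌋+⌈n/2⌉≡n n ⟩
  n                    ∎
  where open ≤-Reasoning

2^⌊log₂n⌋≤n : ∀ n .{{_ : NonZero n}} → 2 ^ ⌊log₂ n ⌋ ≤ n
2^⌊log₂n⌋≤n n = halving n (<-wellFounded n)
  where
  open ≤-Reasoning
  halving : ∀ n → Acc _<_ n → .{{_ : NonZero n}} → 2 ^ ⌊log₂ n ⌋ ≤ n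
  halving 1 _ = ≤-refl
  -- For n ≥ 2, ⌊log₂ n⌋ reduces to a successor, so 1 + (⌊log₂ n⌋ ∸ 1) is ⌊log₂ n⌋.
  halving n@(suc (suc k)) (acc smaller) = begin
    2 ^ ⌊log₂ n ⌋            ≡⟨ cong (λ e → 2 ^ suc e) (sym (⌊log₂⌊n/2⌋⌋≡⌊log₂n⌋∸1 n)) ⟩
    2 * 2 ^ ⌊log₂ ⌊ n /2⌋ ⌋  ≤⟨ *-monoʳ-≤ 2 (halving ⌊ n /2⌋ (smaller (⌊n/2⌋<n (suc k)))) ⟩
    2 * ⌊ n /2⌋              ≤⟨ 2*⌊n/2⌋≤n n ⟩
    n                        ∎

n<2^n : ∀ n → n < 2 ^ n
n<2^n zero    = s≤s z≤n
n<2^n (suc n) = +-mono-≤ (m^n>0 2 n) (≤-trans (n<2^n n) (m≤m+n (2 ^ n) 0))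

n*n≤2*2^n : ∀ n → n * n ≤ 2 * 2 ^ n
n*n≤2*2^n zero    = z≤n
n*n≤2*2^n (suc n) = begin
  suc n * suc n                ≡⟨ square-suc n ⟩
  n * n + suc (2 * n)          ≤⟨ +-mono-≤ (n*n≤2*2^n n) 1+2n≤2*2^n ⟩
  2 * 2 ^ n + 2 * 2 ^ n        ≡⟨ double (2 * 2 ^ n) ⟩
  2 * 2 ^ suc n                ∎
  where
  open ≤-Reasoning
  square-suc : ∀ n → suc n * suc n ≡ n * n + suc (2 * n)
  square-suc = solve-∀
  double : ∀ x → x + x ≡ 2 * x
  double = solve-∀
  1+2n≤2*2^n : suc (2 * n) ≤ 2 * 2 ^ n
  1+2n≤2*2^n =
    ≤-trans (n≤1+n _) (≤-trans (≤-reflexive (sym (*-suc 2 n))) (*-monoʳ-≤ 2 (n<2^n n)))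

[[1+n]*4+2]*n≤14*2^n : ∀ n → (suc n * 4 + 2) * n ≤ 14 * 2 ^ n
[[1+n]*4+2]*n≤14*2^n n = begin
  (suc n * 4 + 2) * n          ≡⟨ expand n ⟩
  4 * (n * n) + 6 * n
    ≤⟨ +-mono-≤ (*-monoʳ-≤ 4 (n*n≤2*2^n n)) (*-monoʳ-≤ 6 (<⇒≤ (n<2^n n))) ⟩
  4 * (2 * 2 ^ n) + 6 * 2 ^ n  ≡⟨ collect (2 ^ n) ⟩
  14 * 2 ^ n                   ∎
  where
  open ≤-Reasoning
  expand : ∀ n → (suc n * 4 + 2) * n ≡ 4 * (n * n) + 6 * n
  expand = solve-∀
  collect : ∀ x → 4 * (2 * x) + 6 * x ≡ 14 * x
  collect = solve-∀

[[1+⌊log₂n⌋]*4+2]*⌊log₂n⌋≤14*n : ∀ n → (suc ⌊log₂ n ⌋ * 4 + 2) * ⌊log₂ n ⌋ ≤ 14 * n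
[[1+⌊log₂n⌋]*4+2]*⌊log₂n⌋≤14*n zero        = z≤n
[[1+⌊log₂n⌋]*4+2]*⌊log₂n⌋≤14*n n@(suc _) =
  ≤-trans ([[1+n]*4+2]*n≤14*2^n ⌊log₂ n ⌋) (*-monoʳ-≤ 14 (2^⌊log₂n⌋≤n n))

n<2^2^[1+⌊log₂⌊log₂n⌋⌋] : ∀ n → n < 2 ^ 2 ^ suc ⌊log₂ ⌊log₂ n ⌋ ⌋
n<2^2^[1+⌊log₂⌊log₂n⌋⌋] n =
  ≤-trans (n<2^[1+⌊log₂n⌋] n) (^-monoʳ-≤ 2 (n<2^[1+⌊log₂n⌋] ⌊log₂ n ⌋))

corollary2 : ∃[ C ] ∃[ N ] ∀ (n : ℕ) → N ≤ n →
    ∀ (G : SimpleGraph) → vertices G ≤ n →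
    ∃[ m ] (m * ⌊log₂ ⌊log₂ n ⌋ ⌋ ≤ C * ⌊log₂ n ⌋ ×
            Σ (Fin m → Family (edges G)) (IsMatroidIntersection G m))
corollary2 = 14 , 0 , λ n _ G |V|≤n →
  let k = suc ⌊log₂ ⌊log₂ n ⌋ ⌋
      |V|≤2^2^k = <⇒≤ (≤-<-trans |V|≤n (n<2^2^[1+⌊log₂⌊log₂n⌋⌋] n))
  in  k * 4 + 2
    , [[1+⌊log₂n⌋]*4+2]*⌊log₂n⌋≤14*n ⌊log₂ n ⌋
    , matchings-as-matroid-intersection G (cherryCover-≤ |V|≤2^2^k (cherryCover-2^2^ k))
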